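{- Let $a=a_1a_2\cdots$ be an infinite word over $\mathbb{N}$ such that $\sigma^i(a)\le_{\mathrm{lex}} a$ for all $i\ge 1$. If $a$ is not purely periodic, define $d=a$; otherwise let $n\ge1$ be the smallest integer such that $a=(a_1\cdots a_n)^\omega$ and define $d=a_1\cdots a_{n-1}(a_n+1)0^\omega$. Then in both cases, $\sigma^i(d)<_{\mathrm{lex}} d$ for all $i\ge 1$.
   Context: $\sigma$ is the shift map $\sigma(w_1w_2w_3\cdots)=w_2w_3\cdots$. For infinite words $u,v$ over $\mathbb{N}$, $u<_{\mathrm{lex}}v$ means there is $n\ge 1$ such that the length-$n$ prefixes satisfy $u_1\cdots u_n<_{\mathrm{lex}}v_1\cdots v_n$, i.e., there is $\ell\le n$ with $u_1\cdots u_{\ell-1}=v_1\cdots v_{\ell-1}$ and $u_\ell<v_\ell$; $u\le_{\mathrm{lex}}v$ means $u<_{\mathrm{lex}}v$ or $u=v$. $w^\omega$ denotes the infinite repetition of the finite word $w$; $a$ is (purely) periodic if $a=w^\omega$ for some nonempty finite word $w$. -}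

module Defs where

open import Data.Nat using (ℕ; zero; suc; _+_; _<_; _≤_; _%_; _<ᵇ_; _≡ᵇ_)
open import Data.Bool using (if_then_else_)
open import Data.Nat.DivMod using (m%n<n)
open import Data.List using (List; []; _∷_; length; lookup)
open import Data.Fin using (fromℕ<)
open import Data.Product using (Σ; _×_; _,_)
open import Data.Sum using (_⊎_)
open import Relation.Nullary using (¬_)
open import Relation.Binary.PropositionalEquality using (_≡_)

-- Infinite words over ℕ, 0-indexed: w k is the letter w_{k+1}.
Word : Set
Word = ℕ → ℕ

_≈w_ : Word → Word → Set
u ≈w v = (k : ℕ) → u k ≡ v k

shift : ℕ → Word → Word
shift i w k = w (i + k)

_<lex_ : Word → Word → Set
u <lex v = Σ ℕ λ ℓ → ((k : ℕ) → k < ℓ → u k ≡ v k) × (u ℓ < v ℓ)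

_≤lex_ : Word → Word → Set
u ≤lex v = (u <lex v) ⊎ (u ≈w v)

omega : ℕ → List ℕ → Word
omega x xs k = lookup (x ∷ xs) (fromℕ< (m%n<n k (length (x ∷ xs))))

Periodic : Word → Set
Periodic a = Σ ℕ λ x → Σ (List ℕ) λ xs → a ≈w omega x xs

prefix : ℕ → Word → List ℕ
prefix zero    w = []
prefix (suc n) w = w 0 ∷ prefix n (λ k → w (suc k))

-- a = (a_1 ⋯ a_{m+1})^ω
HasPeriod : Word → ℕ → Set
HasPeriod a m = a ≈w omega (a 0) (prefix m (λ k → a (suc k)))

MinPeriod : Word → ℕ → Set
MinPeriod a m = HasPeriod a m × ((m' : ℕ) → m' < m → ¬ HasPeriod a m')

-- d = a_1 ⋯ a_{n-1} (a_n + 1) 0^ω  with n = m + 1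
bump : ℕ → Word → Word
bump m a k = if k <ᵇ m then a k else (if k ≡ᵇ m then suc (a k) else 0)

-- A descent of σ^j a below a that happens inside the first period survives the
-- bump (the bumped letter only adds to the left side's deficit, or, if it closes
-- the gap exactly, σ^j d turns into 0^ω while d still has a positive letter),
-- whereas a descent reaching past the period would transport, by periodicity, to
-- an ascent a <lex σ^q a, contradicting the hypothesis. Minimality of the period
-- excludes σ^j a = a for j shorter than the period.
module Submission where

open import Defs
open import Data.Nat using (ℕ; zero; suc; _+_; _*_; _<_; _≤_; _%_; _/_; _<ᵇ_; _≡ᵇ_; _≟_; z<s; s≤s)
open import Data.Nat.Properties
open import Data.Nat.DivMod using (m%n<n; [m+n]%n≡m%n; m≡m%n+[m/n]*n)
open import Data.Bool.Properties using (T-≡; ¬-not)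
open import Data.List using (List; _∷_; length; lookup)
open import Data.Fin using (fromℕ<)
open import Data.Fin.Properties using (fromℕ<-cong)
open import Data.Product using (_×_; _,_)
open import Data.Sum using (_⊎_; inj₁; inj₂)
open import Data.Empty using (⊥-elim)
open import Function.Bundles using (Equivalence)
open import Relation.Nullary using (¬_; yes; no)
open import Relation.Binary.Definitions using (tri<; tri≈; tri>)
open import Relation.Binary.PropositionalEquality

open Equivalence using (to; from)

EqualBelow : ℕ → Word → Word → Set
EqualBelow ℓ u v = (k : ℕ) → k < ℓ → u k ≡ v k

EqualBelow-suc : ∀ {ℓ u v} → EqualBelow ℓ u v → u ℓ ≡ v ℓ → EqualBelow (suc ℓ) u v
EqualBelow-suc agree eq k k<1+ℓ with m≤n⇒m<n∨m≡n (≤-pred k<1+ℓ)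
... | inj₁ k<ℓ = agree k k<ℓ
... | inj₂ refl = eq

<lex⇒¬≥lex : ∀ {u v} → u <lex v → ¬ (v ≤lex u)
<lex⇒¬≥lex (ℓ , agree , lt) (inj₂ eq) = <-irrefl (sym (eq ℓ)) lt
<lex⇒¬≥lex (ℓ , agree , lt) (inj₁ (ℓ′ , agree′ , lt′)) with <-cmp ℓ ℓ′
... | tri< ℓ<ℓ′ _ _ = <-irrefl (sym (agree′ ℓ ℓ<ℓ′)) lt
... | tri≈ _ refl _ = <-asym lt lt′
... | tri> _ _ ℓ′<ℓ = <-irrefl (sym (agree ℓ′ ℓ′<ℓ)) lt′

<lex-zero-tail : ∀ {u v} (s : ℕ) → EqualBelow s u v → ((k : ℕ) → s ≤ k → u k ≡ 0) →
  (n : ℕ) → 0 < v (s + n) → u <lex v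
<lex-zero-tail {u} {v} s agree zeros n pos with v s ≟ 0 | n
... | no vs≢0 | _ = s , agree , subst (_< v s) (sym (zeros s ≤-refl)) (n≢0⇒n>0 vs≢0)
... | yes vs≡0 | zero = ⊥-elim (<-irrefl (sym vs≡0) (subst (λ k → 0 < v k) (+-identityʳ s) pos))
... | yes vs≡0 | suc n′ =
  <lex-zero-tail (suc s) (EqualBelow-suc agree (trans (zeros s ≤-refl) (sym vs≡0)))
    (λ k 1+s≤k → zeros k (<⇒≤ 1+s≤k)) n′ (subst (λ k → 0 < v k) (+-suc s n′) pos)

periodic-+-* : ∀ {a p} → shift p a ≈w a → (r q : ℕ) → a (r + q * p) ≡ a r
periodic-+-* {a} {p} period r zero = cong a (+-identityʳ r)
periodic-+-* {a} {p} period r (suc q) = begin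
  a (r + (p + q * p)) ≡⟨ cong a (+-comm r (p + q * p)) ⟩
  a ((p + q * p) + r) ≡⟨ cong a (+-assoc p (q * p) r) ⟩
  a (p + (q * p + r)) ≡⟨ period (q * p + r) ⟩
  a (q * p + r)       ≡⟨ cong a (+-comm (q * p) r) ⟩
  a (r + q * p)       ≡⟨ periodic-+-* period r q ⟩
  a r                 ∎
  where open ≡-Reasoning

descent-past-period⇒ascent : ∀ {a} j q → shift (j + q) a ≈w a → (r : ℕ) →
  EqualBelow (q + r) (shift j a) a → shift j a (q + r) < a (q + r) → a <lex shift q a
descent-past-period⇒ascent {a} j q period r agree desc =
  r , (λ k k<r → trans (sym (folds k)) (agree (q + k) (+-monoʳ-< q k<r))) , subst (_< a (q + r)) (folds r) desc
  where
  folds : (k : ℕ) → a (j + (q + k)) ≡ a k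
  folds k = trans (cong a (sym (+-assoc j q k))) (period k)

length-prefix : (n : ℕ) (w : Word) → length (prefix n w) ≡ n
length-prefix zero w = refl
length-prefix (suc n) w = cong suc (length-prefix n (λ k → w (suc k)))

lookup-prefix : (n : ℕ) (w : Word) (r : ℕ) (r<n : r < length (prefix n w)) →
  lookup (prefix n w) (fromℕ< r<n) ≡ w r
lookup-prefix (suc n) w zero r<n = refl
lookup-prefix (suc n) w (suc r) (s≤s r<n) = lookup-prefix n (λ k → w (suc k)) r r<n

omega-periodic : (x : ℕ) (xs : List ℕ) → shift (length (x ∷ xs)) (omega x xs) ≈w omega x xs
omega-periodic x xs k = cong (lookup (x ∷ xs)) (fromℕ<-cong _ _ (begin
  (L + k) % L ≡⟨ cong (_% L) (+-comm L k) ⟩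
  (k + L) % L ≡⟨ [m+n]%n≡m%n k L ⟩
  k % L       ∎) _ _)
  where
  open ≡-Reasoning
  L = length (x ∷ xs)

hasPeriod⇒shift≈ : ∀ {a m} → HasPeriod a m → shift (suc m) a ≈w a
hasPeriod⇒shift≈ {a} {m} period k = begin
  a (suc m + k) ≡⟨ cong (λ p → a (p + k)) (sym (length-prefix (suc m) a)) ⟩
  a (L + k)     ≡⟨ period (L + k) ⟩
  ω (L + k)     ≡⟨ omega-periodic (a 0) (prefix m (λ k → a (suc k))) k ⟩
  ω k           ≡⟨ sym (period k) ⟩
  a k           ∎
  where
  open ≡-Reasoning
  L = length (prefix (suc m) a)
  ω = omega (a 0) (prefix m (λ k → a (suc k)))

shift≈⇒hasPeriod : ∀ {a m} → shift (suc m) a ≈w a → HasPeriod a m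
shift≈⇒hasPeriod {a} {m} period k = begin
  a k                   ≡⟨ cong a (m≡m%n+[m/n]*n k L) ⟩
  a (k % L + k / L * L) ≡⟨ periodic-+-* periodL (k % L) (k / L) ⟩
  a (k % L)             ≡⟨ sym (lookup-prefix (suc m) a (k % L) (m%n<n k L)) ⟩
  omega (a 0) (prefix m (λ k → a (suc k))) k ∎
  where
  open ≡-Reasoning
  L = length (prefix (suc m) a)
  periodL : shift L a ≈w a
  periodL = subst (λ p → shift p a ≈w a) (sym (length-prefix (suc m) a)) period

bump-< : ∀ m a {k} → k < m → bump m a k ≡ a k
bump-< m a k<m rewrite to T-≡ (<⇒<ᵇ k<m) = refl

bump-≡ : ∀ m a → bump m a m ≡ suc (a m)
bump-≡ m a rewrite ¬-not {m <ᵇ m} (λ eq → <-irrefl refl (<ᵇ⇒< m m (from T-≡ eq)))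
                 | to T-≡ (≡⇒≡ᵇ m m refl) = refl

bump-> : ∀ m a {k} → m < k → bump m a k ≡ 0
bump-> m a {k} m<k
  rewrite ¬-not {k <ᵇ m} (λ eq → <-asym m<k (<ᵇ⇒< k m (from T-≡ eq)))
        | ¬-not {k ≡ᵇ m} (λ eq → <-irrefl (sym (≡ᵇ⇒≡ k m (from T-≡ eq))) m<k) = refl

bump-positive : ∀ m a → 0 < bump m a m
bump-positive m a = subst (0 <_) (sym (bump-≡ m a)) z<s

shift-bump-beyond : ∀ {a m j} → m < j → shift j (bump m a) <lex bump m a
shift-bump-beyond {a} {m} {j} m<j =
  <lex-zero-tail 0 (λ k ()) (λ k _ → bump-> m a (<-≤-trans m<j (m≤m+n j k))) m (bump-positive m a)

shift-bump-EqualBelow : ∀ {a m j ℓ} → j + ℓ ≤ m → EqualBelow ℓ (shift j a) a →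
  EqualBelow ℓ (shift j (bump m a)) (bump m a)
shift-bump-EqualBelow {a} {m} {j} {ℓ} j+ℓ≤m agree k k<ℓ =
  trans (bump-< m a (<-≤-trans (+-monoʳ-< j k<ℓ) j+ℓ≤m))
    (trans (agree k k<ℓ) (sym (bump-< m a (<-≤-trans k<ℓ (≤-trans (m≤n+m ℓ j) j+ℓ≤m)))))

shift-bump-<lex-at-bump : ∀ {a} i ℓ → EqualBelow ℓ (shift (suc i) a) a →
  shift (suc i) a ℓ < a ℓ → shift (suc i) (bump (suc i + ℓ) a) <lex bump (suc i + ℓ) a
shift-bump-<lex-at-bump {a} i ℓ agree desc = conclude (m≤n⇒m<n∨m≡n desc)
  where
  m = suc i + ℓ
  ℓ<m : ℓ < m
  ℓ<m = s≤s (m≤n+m ℓ i)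
  agree′ : EqualBelow ℓ (shift (suc i) (bump m a)) (bump m a)
  agree′ = shift-bump-EqualBelow ≤-refl agree
  conclude : suc (a m) < a ℓ ⊎ suc (a m) ≡ a ℓ → shift (suc i) (bump m a) <lex bump m a
  conclude (inj₁ bumped<aℓ) =
    ℓ , agree′ , subst₂ _<_ (sym (bump-≡ m a)) (sym (bump-< m a ℓ<m)) bumped<aℓ
  conclude (inj₂ bumped≡aℓ) =
    <lex-zero-tail (suc ℓ) (EqualBelow-suc agree′ (trans (bump-≡ m a) (trans bumped≡aℓ (sym (bump-< m a ℓ<m)))))
      (λ k 1+ℓ≤k → bump-> m a (+-monoʳ-< (suc i) 1+ℓ≤k))
      i (subst (λ k → 0 < bump m a k) (cong suc (+-comm i ℓ)) (bump-positive m a))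

shift-bump-<lex : ∀ {a} i ℓ m → suc i + ℓ ≤ m → EqualBelow ℓ (shift (suc i) a) a →
  shift (suc i) a ℓ < a ℓ → shift (suc i) (bump m a) <lex bump m a
shift-bump-<lex {a} i ℓ m j+ℓ≤m agree desc with m≤n⇒m<n∨m≡n j+ℓ≤m
... | inj₂ refl = shift-bump-<lex-at-bump i ℓ agree desc
... | inj₁ j+ℓ<m =
  ℓ , shift-bump-EqualBelow j+ℓ≤m agree , subst₂ _<_ (sym (bump-< m a j+ℓ<m)) (sym (bump-< m a ℓ<m)) desc
  where
  ℓ<m : ℓ < m
  ℓ<m = <-≤-trans (s≤s (m≤n+m ℓ i)) j+ℓ≤m

lemma4 : (a : Word) → ((i : ℕ) → shift (suc i) a ≤lex a) →
    ((¬ Periodic a) → (i : ℕ) → shift (suc i) a <lex a)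
    × ((m : ℕ) → MinPeriod a m → (i : ℕ) → shift (suc i) (bump m a) <lex bump m a)
lemma4 a noAscent = aperiodic , periodic
  where
  aperiodic : (¬ Periodic a) → (i : ℕ) → shift (suc i) a <lex a
  aperiodic notPeriodic i with noAscent i
  ... | inj₁ descent = descent
  ... | inj₂ eq = ⊥-elim (notPeriodic (a 0 , prefix i (λ k → a (suc k)) , shift≈⇒hasPeriod eq))

  periodic : (m : ℕ) → MinPeriod a m → (i : ℕ) → shift (suc i) (bump m a) <lex bump m a
  periodic m (period , minimal) i with ≤-<-connex (suc i) m
  ... | inj₂ m<j = shift-bump-beyond m<j
  ... | inj₁ j≤m with noAscent i
  ...   | inj₂ eq = ⊥-elim (minimal i j≤m (shift≈⇒hasPeriod eq))
  ...   | inj₁ (ℓ , agree , desc) with m≤n⇒∃[o]m+o≡n j≤m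
  ...     | c , refl with ≤-<-connex ℓ c
  ...       | inj₁ ℓ≤c = shift-bump-<lex i ℓ m (+-monoʳ-≤ (suc i) ℓ≤c) agree desc
  ...       | inj₂ c<ℓ with m≤n⇒∃[o]m+o≡n c<ℓ
  ...         | r , refl = ⊥-elim (<lex⇒¬≥lex ascent (noAscent c))
    where
    ascent : a <lex shift (suc c) a
    ascent = descent-past-period⇒ascent (suc i) (suc c)
      (subst (λ p → shift p a ≈w a) (sym (+-suc (suc i) c)) (hasPeriod⇒shift≈ period)) r agree desc
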